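{- Let $n\ge1$. The only symmetric Boolean functions $f : \{0,1\}^n \to \{0,1\}$ with $\mathsf{C}_{\mathsf{min}}(f) = n$ are the parity function $\mathsf{XOR}_n$ and its negation $1-\mathsf{XOR}_n$.
   Context: A function $f:\{0,1\}^n\to\{0,1\}$ is symmetric if $f(x)$ depends only on the Hamming weight $|x|$. $\mathsf{XOR}_n(x)=1$ iff $|x|$ is odd. A certificate for $x$ w.r.t. $f$ is a set $S\subseteq[n]$ such that $f(y)=f(x)$ for all $y$ agreeing with $x$ on $S$; $\mathsf{C}(f,x)$ is the minimum size of such a set, and $\mathsf{C}_{\mathsf{min}}(f)=\min_{x} \mathsf{C}(f,x)$. -}

module Defs where

open import Data.Nat using (ℕ; _≤_; _≥_)
open import Data.Bool using (Bool; true; false; not; _xor_)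
open import Data.Vec using (Vec; lookup; count; foldr)
open import Data.Fin using (Fin)
open import Data.Fin.Subset using (Subset; inside; _∈_; ∣_∣)
open import Data.Product using (Σ; _×_; ∃)
open import Relation.Binary.PropositionalEquality using (_≡_)

-- Inputs of length n are Boolean vectors; 1 = true.
BoolFun : ℕ → Set
BoolFun n = Vec Bool n → Bool

weight : ∀ {n} → Vec Bool n → ℕ
weight {n} x = count (λ b → b Data.Bool.≟ true) x

Symmetric : ∀ {n} → BoolFun n → Set
Symmetric {n} f = ∀ (x y : Vec Bool n) → weight x ≡ weight y → f x ≡ f y

XOR : ∀ n → BoolFun n
XOR n x = foldr (λ _ → Bool) _xor_ false x

AgreeOn : ∀ {n} → Subset n → Vec Bool n → Vec Bool n → Set
AgreeOn S x y = ∀ i → i ∈ S → lookup x i ≡ lookup y i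

IsCertificate : ∀ {n} → BoolFun n → Vec Bool n → Subset n → Set
IsCertificate f x S = ∀ y → AgreeOn S x y → f y ≡ f x

CertComplexityIs : ∀ {n} → BoolFun n → Vec Bool n → ℕ → Set
CertComplexityIs {n} f x k =
  (Σ (Subset n) λ S → IsCertificate f x S × ∣ S ∣ ≡ k)
  × (∀ (S : Subset n) → IsCertificate f x S → k ≤ ∣ S ∣)

CminIs : ∀ {n} → BoolFun n → ℕ → Set
CminIs {n} f m =
  (Σ (Vec Bool n) λ x → CertComplexityIs f x m)
  × (∀ (x : Vec Bool n) (k : ℕ) → CertComplexityIs f x k → m ≤ k)

-- If some input x had a coordinate i on which f is insensitive, then all coordinates except i
-- would certify x, so C_min(f) ≤ n − 1. Hence C_min(f) = n makes f flip whenever any single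
-- bit flips, and walking from the all-zeros input one bit at a time gives f x = f 0 ⊕ XOR_n x.
{-# OPTIONS --safe #-}
module Submission where

open import Defs
open import Data.Nat using (ℕ; zero; suc; _≥_; _≤_; _<_; _∸_)
open import Data.Nat.Properties using (_≤?_; ≰⇒>; ≤-<-trans; <-trans; <-irrefl; n<1+n; module ≤-Reasoning)
open import Data.Nat.Induction using (<-rec)
open import Data.Bool as Bool using (Bool; not; true; false; _xor_)
open import Data.Bool.Properties using (¬-not; not-distribʳ-xor; xor-identityʳ)
open import Data.Vec using (Vec; []; _∷_; lookup; replicate; _[_]%=_)
open import Data.Vec.Base using (there)
open import Data.Vec.Properties using (tabulate∘lookup; tabulate-cong)
open import Data.Fin using (Fin; zero; suc)
open import Data.Fin.Subset using (Subset; ∁; ⁅_⁆; ∣_∣; _∈_)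
open import Data.Fin.Subset.Properties using (∣∁p∣≡n∸∣p∣; ∣⁅x⁆∣≡1; x∉p⇒x∈∁p; x≢y⇒x∉⁅y⁆)
open import Data.Sum using (_⊎_; inj₁; inj₂)
open import Data.Product using (_,_; proj₂; Σ; _×_)
open import Function using (_∘_)
open import Relation.Nullary using (yes; no; contradiction)
open import Relation.Binary.PropositionalEquality
  using (_≡_; _≢_; refl; sym; trans; cong; module ≡-Reasoning)

least-lower-bound⇒lower-bound : ∀ {P : ℕ → Set} {b} →
  (∀ k → P k → (∀ j → P j → k ≤ j) → b ≤ k) → ∀ m → P m → b ≤ m
least-lower-bound⇒lower-bound {P} {b} bound = <-rec (λ m → P m → b ≤ m) step
  where
  step : ∀ m → (∀ {j} → j < m → P j → b ≤ j) → P m → b ≤ m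
  step m ih pm with b ≤? m
  ... | yes b≤m = b≤m
  ... | no b≰m = bound m pm m-least
    where
    m-least : ∀ j → P j → m ≤ j
    m-least j pj with m ≤? j
    ... | yes m≤j = m≤j
    ... | no m≰j = contradiction (≤-<-trans (ih j<m pj) (<-trans j<m (≰⇒> b≰m))) (<-irrefl refl)
      where
      j<m : j < m
      j<m = ≰⇒> m≰j

Cmin≤∣certificate∣ : ∀ {n} {f : BoolFun n} {m x S} →
  CminIs f m → IsCertificate f x S → m ≤ ∣ S ∣
Cmin≤∣certificate∣ {f = f} {x = x} {S} cmin cert =
  least-lower-bound⇒lower-bound
    {P = λ k → Σ (Subset _) λ T → IsCertificate f x T × ∣ T ∣ ≡ k}
    (λ k certₖ least → proj₂ cmin x k (certₖ , λ T certT → least ∣ T ∣ (T , certT , refl)))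
    ∣ S ∣ (S , cert , refl)

lookup-ext : ∀ {A : Set} {n} (x y : Vec A n) → (∀ j → lookup x j ≡ lookup y j) → x ≡ y
lookup-ext x y eq = trans (sym (tabulate∘lookup x)) (trans (tabulate-cong eq) (tabulate∘lookup y))

x≢y⇒x∈∁⁅y⁆ : ∀ {n} {x y : Fin n} → x ≢ y → x ∈ ∁ ⁅ y ⁆
x≢y⇒x∈∁⁅y⁆ x≢y = x∉p⇒x∈∁p (x≢y⇒x∉⁅y⁆ x≢y)

agreeOff⇒≡∨flipped : ∀ {n} (i : Fin n) (x y : Vec Bool n) →
  AgreeOn (∁ ⁅ i ⁆) x y → y ≡ x ⊎ y ≡ x [ i ]%= not
agreeOff⇒≡∨flipped zero (a ∷ x) (b ∷ y) agree
  with lookup-ext x y (λ j → agree (suc j) (x≢y⇒x∈∁⁅y⁆ {y = zero} λ ())) | b Bool.≟ a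
... | refl | yes refl = inj₁ refl
... | refl | no b≢a rewrite ¬-not b≢a = inj₂ refl
agreeOff⇒≡∨flipped (suc i) (a ∷ x) (b ∷ y) agree
  with agree zero (x≢y⇒x∈∁⁅y⁆ {y = suc i} λ ())
  | agreeOff⇒≡∨flipped i x y (λ j j∈ → agree (suc j) (there j∈))
... | refl | inj₁ refl = inj₁ refl
... | refl | inj₂ refl = inj₂ refl

FullySensitive : ∀ {n} → BoolFun n → Set
FullySensitive f = ∀ x i → f (x [ i ]%= not) ≢ f x

fullySensitive-∷ : ∀ {n} {f : BoolFun (suc n)} b → FullySensitive f → FullySensitive (f ∘ (b ∷_))
fullySensitive-∷ b sensitive x i = sensitive (b ∷ x) (suc i)

insensitive⇒certificate : ∀ {n} (f : BoolFun n) (x : Vec Bool n) (i : Fin n) →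
  f (x [ i ]%= not) ≡ f x → IsCertificate f x (∁ ⁅ i ⁆)
insensitive⇒certificate f x i insensitive y agree with agreeOff⇒≡∨flipped i x y agree
... | inj₁ refl = refl
... | inj₂ refl = insensitive

∣∁⁅i⁆∣≡n∸1 : ∀ {n} (i : Fin n) → ∣ ∁ ⁅ i ⁆ ∣ ≡ n ∸ 1
∣∁⁅i⁆∣≡n∸1 {n} i = trans (∣∁p∣≡n∸∣p∣ ⁅ i ⁆) (cong (n ∸_) (∣⁅x⁆∣≡1 i))

Cmin≡n⇒fullySensitive : ∀ {n} (f : BoolFun n) → CminIs f n → FullySensitive f
Cmin≡n⇒fullySensitive {suc n} f cmin x i insensitive = <-irrefl refl (begin-strict
  n              <⟨ n<1+n n ⟩
  suc n          ≤⟨ Cmin≤∣certificate∣ cmin (insensitive⇒certificate f x i insensitive) ⟩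
  ∣ ∁ ⁅ i ⁆ ∣    ≡⟨ ∣∁⁅i⁆∣≡n∸1 i ⟩
  n              ∎)
  where open ≤-Reasoning

fullySensitive⇒parity : ∀ {n} (f : BoolFun n) → FullySensitive f →
  ∀ x → f x ≡ f (replicate n false) xor XOR n x
fullySensitive⇒parity {zero} f _ [] = sym (xor-identityʳ (f []))
fullySensitive⇒parity {suc n} f sensitive (false ∷ x) =
  fullySensitive⇒parity (f ∘ (false ∷_)) (fullySensitive-∷ false sensitive) x
fullySensitive⇒parity {suc n} f sensitive (true ∷ x) = begin
  f (true ∷ x)          ≡⟨ ¬-not (sensitive (false ∷ x) zero) ⟩
  not (f (false ∷ x))   ≡⟨ cong not (fullySensitive⇒parity (f ∘ (false ∷_)) (fullySensitive-∷ false sensitive) x) ⟩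
  not (f₀ xor XOR n x)  ≡⟨ not-distribʳ-xor f₀ (XOR n x) ⟩
  f₀ xor not (XOR n x)  ∎
  where
  open ≡-Reasoning
  f₀ : Bool
  f₀ = f (replicate (suc n) false)

corollary3p3 : (n : ℕ) → n ≥ 1 → (f : BoolFun n) → Symmetric f → CminIs f n →
    (∀ (x : Vec Bool n) → f x ≡ XOR n x) ⊎ (∀ (x : Vec Bool n) → f x ≡ not (XOR n x))
corollary3p3 n _ f _ cmin =
  xor-XOR (f (replicate n false)) (fullySensitive⇒parity f (Cmin≡n⇒fullySensitive f cmin))
  where
  xor-XOR : ∀ b → (∀ x → f x ≡ b xor XOR n x) →
    (∀ x → f x ≡ XOR n x) ⊎ (∀ x → f x ≡ not (XOR n x))
  xor-XOR false = inj₁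
  xor-XOR true = inj₂
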